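{- Let $n$ be even and suppose there exists a Hadamard matrix of order $n$. Then each of the graphs $K_n$, $K_{n/2,n/2}$, $nK_1$, and $2K_{n/2}$ is Hadamard diagonalizable.
   Context: Graphs are finite and simple. A (real) Hadamard matrix of order $n$ is an $n\times n$ matrix $H$ with entries in $\{1,-1\}$ such that $H^TH=nI$. The Laplacian matrix $L$ of a graph $G$ is defined by $L_{uu}=\deg(u)$, $L_{uv}=-1$ if $u\neq v$ are adjacent, and $L_{uv}=0$ otherwise. $G$ is Hadamard diagonalizable if there is a Hadamard matrix $H$ of order $n=|V(G)|$ such that $\frac1n H^TLH$ is a diagonal matrix. $K_n$ is the complete graph, $K_{a,b}$ the complete bipartite graph, $nK_1$ the edgeless graph on $n$ vertices, and $2K_{n/2}$ the disjoint union of two copies of $K_{n/2}$. -}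

module Defs where

open import Data.Nat as ℕ using (ℕ; _<ᵇ_)
open import Data.Integer as ℤ using (ℤ; +_; -_; _+_; _*_; 0ℤ; 1ℤ)
open import Data.Fin using (Fin; toℕ; _≟_)
open import Data.Bool using (Bool; true; false; not; _∧_; _xor_; if_then_else_)
open import Data.Sum using (_⊎_)
open import Data.Product using (Σ; _×_; ∃)
open import Relation.Binary.PropositionalEquality using (_≡_; _≢_; refl; cong; cong₂)
open import Relation.Nullary.Decidable using (⌊_⌋)

Matrix : ℕ → Set
Matrix n = Fin n → Fin n → ℤ

sumFin : (n : ℕ) → (Fin n → ℤ) → ℤ
sumFin ℕ.zero f = 0ℤ
sumFin (ℕ.suc n) f = f Data.Fin.zero + sumFin n (λ k → f (Data.Fin.suc k))

infixl 7 _⊗_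
_⊗_ : {n : ℕ} → Matrix n → Matrix n → Matrix n
_⊗_ {n} A B i j = sumFin n (λ k → A i k * B k j)

transpose : {n : ℕ} → Matrix n → Matrix n
transpose A i j = A j i

scalarId : {n : ℕ} → ℤ → Matrix n
scalarId c i j = if ⌊ i ≟ j ⌋ then c else 0ℤ

record Graph (n : ℕ) : Set where
  field
    adj : Fin n → Fin n → Bool
    sym : ∀ i j → adj i j ≡ adj j i
    irrefl : ∀ i → adj i i ≡ false
open Graph public

degree : {n : ℕ} → Graph n → Fin n → ℤ
degree {n} G u = sumFin n (λ v → if adj G u v then 1ℤ else 0ℤ)

laplacian : {n : ℕ} → Graph n → Matrix n
laplacian G u v = if ⌊ u ≟ v ⌋ then degree G u else (if adj G u v then - 1ℤ else 0ℤ)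

IsHadamard : (n : ℕ) → Matrix n → Set
IsHadamard n H = (∀ i j → (H i j ≡ 1ℤ) ⊎ (H i j ≡ - 1ℤ))
               × (∀ i j → (transpose H ⊗ H) i j ≡ scalarId (+ n) i j)

IsDiagonal : {n : ℕ} → Matrix n → Set
IsDiagonal M = ∀ i j → i ≢ j → M i j ≡ 0ℤ

-- G is Hadamard diagonalizable: some Hadamard H with (1/n) Hᵀ L H diagonal.
-- The factor 1/n (n > 0 whenever a vertex exists) does not affect diagonality,
-- so we require Hᵀ L H itself to be diagonal (an integer matrix).
HadamardDiagonalizable : {n : ℕ} → Graph n → Set
HadamardDiagonalizable {n} G =
  Σ (Matrix n) (λ H → IsHadamard n H × IsDiagonal (transpose H ⊗ laplacian G ⊗ H))

eqℕ : ℕ → ℕ → Bool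
eqℕ ℕ.zero ℕ.zero = true
eqℕ ℕ.zero (ℕ.suc _) = false
eqℕ (ℕ.suc _) ℕ.zero = false
eqℕ (ℕ.suc a) (ℕ.suc b) = eqℕ a b

eqℕ-sym : ∀ a b → eqℕ a b ≡ eqℕ b a
eqℕ-sym ℕ.zero ℕ.zero = refl
eqℕ-sym ℕ.zero (ℕ.suc _) = refl
eqℕ-sym (ℕ.suc _) ℕ.zero = refl
eqℕ-sym (ℕ.suc a) (ℕ.suc b) = eqℕ-sym a b

eqℕ-refl : ∀ a → eqℕ a a ≡ true
eqℕ-refl ℕ.zero = refl
eqℕ-refl (ℕ.suc a) = eqℕ-refl a

xor-comm : ∀ a b → a xor b ≡ b xor a
xor-comm true true = refl
xor-comm true false = refl
xor-comm false true = refl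
xor-comm false false = refl

xor-self : ∀ a → a xor a ≡ false
xor-self true = refl
xor-self false = refl

neq : {n : ℕ} → Fin n → Fin n → Bool
neq i j = not (eqℕ (toℕ i) (toℕ j))

side : {m : ℕ} → Fin (m ℕ.+ m) → Bool
side {m} i = toℕ i <ᵇ m

completeGraph : (n : ℕ) → Graph n
completeGraph n = record
  { adj = neq
  ; sym = λ i j → cong not (eqℕ-sym (toℕ i) (toℕ j))
  ; irrefl = λ i → cong not (eqℕ-refl (toℕ i)) }

edgelessGraph : (n : ℕ) → Graph n
edgelessGraph n = record { adj = λ _ _ → false ; sym = λ _ _ → refl ; irrefl = λ _ → refl }

completeBipartiteGraph : (m : ℕ) → Graph (m ℕ.+ m)
completeBipartiteGraph m = record
  { adj = λ i j → side {m} i xor side {m} j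
  ; sym = λ i j → xor-comm (side {m} i) (side {m} j)
  ; irrefl = λ i → xor-self (side {m} i) }

twoCliquesGraph : (m : ℕ) → Graph (m ℕ.+ m)
twoCliquesGraph m = record
  { adj = λ i j → not (side {m} i xor side {m} j) ∧ neq i j
  ; sym = λ i j → cong₂ (λ a b → not a ∧ b) (xor-comm (side {m} i) (side {m} j))
                        (cong not (eqℕ-sym (toℕ i) (toℕ j)))
  ; irrefl = λ i → aux (not (side {m} i xor side {m} i)) (cong not (eqℕ-refl (toℕ i))) }
  where
    aux : ∀ a {b} → b ≡ false → a ∧ b ≡ false
    aux true refl = refl
    aux false _ = refl

-- If HᵀH = nI and every column of H is an eigenvector of L, then HᵀLH is diagonal.
-- Rescaling the rows of a Hadamard matrix by ±1 makes one column the all-ones vector 𝟙;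
-- every other column is orthogonal to it, hence has m entries 1 and m entries −1, and
-- sorting the rows by such a column turns it into s = (1,…,1,−1,…,−1). Each of the four
-- graphs has 2A = aI + bJ + g s sᵀ with J = 𝟙𝟙ᵀ, so 2L = bnI − bJ − g s sᵀ. Since 𝟙 and s
-- are columns of H, J and s sᵀ send every column of H to a multiple of itself (zero unless
-- it is 𝟙, resp. s), so the columns of H are eigenvectors of L.

module Submission where

module HadamardDiagonalization where

  open import Defs hiding (sym)
  open import Data.Nat as ℕ using (ℕ; zero; suc; _<_; _<ᵇ_)
  import Data.Nat.Properties as ℕ
  open import Data.Integer as ℤ using (ℤ; +_; -_; _+_; _-_; _*_; 0ℤ; 1ℤ)
  open import Data.Integer.Properties hiding (_≟_)
  open import Data.Integer.Tactic.RingSolver using (solve-∀)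
  open import Data.Fin using (Fin; toℕ; _≟_; _↑ʳ_) renaming (zero to fzero; suc to fsuc)
  open import Data.Fin.Properties using (toℕ<n; toℕ-injective)
  open import Data.Bool using (true; false; not; if_then_else_)
  open import Data.Empty using (⊥-elim)
  open import Data.Sum using (_⊎_; inj₁; inj₂)
  open import Data.Product using (Σ; Σ-syntax; _×_; _,_; proj₁)
  open import Data.List using (List; []; _∷_; _++_; length; tabulate; filter)
  open import Data.List.Properties using (length-++; length-tabulate)
  open import Data.List.Relation.Unary.All as All using (All; []; _∷_)
  open import Data.List.Relation.Unary.All.Properties using (all-filter; filter⁺; ++⁺; tabulate⁺)
  open import Function using (_∘_)
  open import Level using (0ℓ)
  open import Relation.Binary.PropositionalEquality
  open import Relation.Nullary using (yes; no)
  open import Relation.Nullary.Reflects using (ofʸ; ofⁿ)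
  open import Relation.Unary using (Pred; Decidable)
  open import Relation.Unary.Properties using (∁?)
  open import Algebra.Properties.CommutativeSemigroup *-commutativeSemigroup using (x∙yz≈y∙xz)
  open import Algebra.Properties.CommutativeSemigroup +-commutativeSemigroup
    using () renaming (x∙yz≈y∙xz to x+[y+z]≡y+[x+z])
  open import Algebra.Properties.Semiring.Sum +-*-semiring
    using (sum; sum-cong-≗; ∑-distrib-+; ∑-comm; *-distribˡ-sum; *-distribʳ-sum)

  open ≡-Reasoning

  sumFin≡sum : ∀ n (f : Fin n → ℤ) → sumFin n f ≡ sum f
  sumFin≡sum zero    f = refl
  sumFin≡sum (suc n) f = cong (_+_ (f fzero)) (sumFin≡sum n (f ∘ fsuc))

  sumFin-cong : ∀ n {f g : Fin n → ℤ} → (∀ k → f k ≡ g k) → sumFin n f ≡ sumFin n g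
  sumFin-cong n {f} {g} f≗g =
    trans (sumFin≡sum n f) (trans (sum-cong-≗ f≗g) (sym (sumFin≡sum n g)))

  sumFin-distrib-+ : ∀ n (f g : Fin n → ℤ) →
                     sumFin n (λ k → f k + g k) ≡ sumFin n f + sumFin n g
  sumFin-distrib-+ n f g = begin
    sumFin n (λ k → f k + g k) ≡⟨ sumFin≡sum n _ ⟩
    sum (λ k → f k + g k)      ≡⟨ ∑-distrib-+ f g ⟩
    sum f + sum g              ≡⟨ sym (cong₂ _+_ (sumFin≡sum n f) (sumFin≡sum n g)) ⟩
    sumFin n f + sumFin n g    ∎

  sumFin-*ˡ : ∀ n c (f : Fin n → ℤ) → sumFin n (λ k → c * f k) ≡ c * sumFin n f
  sumFin-*ˡ n c f = begin
    sumFin n (λ k → c * f k) ≡⟨ sumFin≡sum n _ ⟩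
    sum (λ k → c * f k)      ≡⟨ sym (*-distribˡ-sum c f) ⟩
    c * sum f                ≡⟨ cong (c *_) (sym (sumFin≡sum n f)) ⟩
    c * sumFin n f           ∎

  sumFin-*ʳ : ∀ n c (f : Fin n → ℤ) → sumFin n (λ k → f k * c) ≡ sumFin n f * c
  sumFin-*ʳ n c f = begin
    sumFin n (λ k → f k * c) ≡⟨ sumFin≡sum n _ ⟩
    sum (λ k → f k * c)      ≡⟨ sym (*-distribʳ-sum c f) ⟩
    sum f * c                ≡⟨ cong (_* c) (sym (sumFin≡sum n f)) ⟩
    sumFin n f * c           ∎

  sumFin-comm : ∀ n (f : Fin n → Fin n → ℤ) →
                sumFin n (λ i → sumFin n (f i)) ≡ sumFin n (λ j → sumFin n (λ i → f i j))
  sumFin-comm n f = begin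
    sumFin n (λ i → sumFin n (f i))           ≡⟨ sumFin-cong n (λ i → sumFin≡sum n (f i)) ⟩
    sumFin n (λ i → sum (f i))                ≡⟨ sumFin≡sum n _ ⟩
    sum (λ i → sum (f i))                     ≡⟨ ∑-comm f ⟩
    sum (λ j → sum (λ i → f i j))             ≡⟨ sym (sumFin≡sum n _) ⟩
    sumFin n (λ j → sum (λ i → f i j))        ≡⟨ sumFin-cong n (λ j → sym (sumFin≡sum n _)) ⟩
    sumFin n (λ j → sumFin n (λ i → f i j))   ∎

  sumFin-const : ∀ n c → sumFin n (λ _ → c) ≡ c * + n
  sumFin-const zero    c = sym (*-zeroʳ c)
  sumFin-const (suc n) c = trans (cong (_+_ c) (sumFin-const n c)) (sym (*-suc c (+ n)))

  sumFin-linear₃ : ∀ n a b c (f g h : Fin n → ℤ) →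
    sumFin n (λ k → a * f k + b * g k + c * h k)
    ≡ a * sumFin n f + b * sumFin n g + c * sumFin n h
  sumFin-linear₃ n a b c f g h = begin
    sumFin n (λ k → a * f k + b * g k + c * h k)
      ≡⟨ sumFin-distrib-+ n _ _ ⟩
    sumFin n (λ k → a * f k + b * g k) + sumFin n (λ k → c * h k)
      ≡⟨ cong (_+ sumFin n (λ k → c * h k)) (sumFin-distrib-+ n _ _) ⟩
    sumFin n (λ k → a * f k) + sumFin n (λ k → b * g k) + sumFin n (λ k → c * h k)
      ≡⟨ cong₂ _+_ (cong₂ _+_ (sumFin-*ˡ n a f) (sumFin-*ˡ n b g)) (sumFin-*ˡ n c h) ⟩
    a * sumFin n f + b * sumFin n g + c * sumFin n h ∎

  δ : ∀ {n} → Matrix n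
  δ = scalarId 1ℤ

  scalarId-≢ : ∀ {n} c {i j : Fin n} → i ≢ j → scalarId c i j ≡ 0ℤ
  scalarId-≢ c {i} {j} i≢j with i ≟ j
  ... | yes i≡j = ⊥-elim (i≢j i≡j)
  ... | no _    = refl

  scalarId-swap : ∀ {n} (f : Fin n → ℤ) c (i j : Fin n) → f i * scalarId c i j ≡ scalarId c i j * f j
  scalarId-swap f c i j with i ≟ j
  ... | yes refl = *-comm (f i) c
  ... | no _     = trans (*-zeroʳ (f i)) (sym (*-zeroˡ (f j)))

  scalarId-suc : ∀ {n} c (i j : Fin n) → scalarId c (fsuc i) (fsuc j) ≡ scalarId c i j
  scalarId-suc c i j with i ≟ j
  ... | yes _ = refl
  ... | no _  = refl

  sumFin-δ : ∀ n (f : Fin n → ℤ) k → sumFin n (λ l → δ k l * f l) ≡ f k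
  sumFin-δ (suc n) f fzero = begin
    1ℤ * f fzero + sumFin n (λ l → 0ℤ * f (fsuc l))
      ≡⟨ cong₂ _+_ (*-identityˡ (f fzero)) (sumFin-cong n (λ l → *-zeroˡ (f (fsuc l)))) ⟩
    f fzero + sumFin n (λ _ → 0ℤ)
      ≡⟨ cong (_+_ (f fzero)) (trans (sumFin-const n 0ℤ) (*-zeroˡ (+ n))) ⟩
    f fzero + 0ℤ
      ≡⟨ +-identityʳ (f fzero) ⟩
    f fzero ∎
  sumFin-δ (suc n) f (fsuc k) = begin
    0ℤ * f fzero + sumFin n (λ l → δ (fsuc k) (fsuc l) * f (fsuc l))
      ≡⟨ cong₂ _+_ (*-zeroˡ (f fzero))
           (trans (sumFin-cong n (λ l → cong (_* f (fsuc l)) (scalarId-suc 1ℤ k l)))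
                  (sumFin-δ n (f ∘ fsuc) k)) ⟩
    0ℤ + f (fsuc k)
      ≡⟨ +-identityˡ (f (fsuc k)) ⟩
    f (fsuc k) ∎

  ⊗-assoc : ∀ {n} (A B C : Matrix n) i j → (A ⊗ B ⊗ C) i j ≡ (A ⊗ (B ⊗ C)) i j
  ⊗-assoc {n} A B C i j = begin
    sumFin n (λ k → sumFin n (λ l → A i l * B l k) * C k j)
      ≡⟨ sumFin-cong n (λ k → sym (sumFin-*ʳ n (C k j) (λ l → A i l * B l k))) ⟩
    sumFin n (λ k → sumFin n (λ l → A i l * B l k * C k j))
      ≡⟨ sumFin-comm n _ ⟩
    sumFin n (λ l → sumFin n (λ k → A i l * B l k * C k j))
      ≡⟨ sumFin-cong n (λ l → trans (sumFin-cong n (λ k → *-assoc (A i l) (B l k) (C k j)))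
                                    (sumFin-*ˡ n (A i l) (λ k → B l k * C k j))) ⟩
    sumFin n (λ l → A i l * sumFin n (λ k → B l k * C k j)) ∎

  eigencolumns⇒diagonal : ∀ {n} (H L : Matrix n) (c : ℤ) .{{_ : ℤ.NonZero c}} (μ : Fin n → ℤ) →
    IsDiagonal (transpose H ⊗ H) →
    (∀ k j → c * (L ⊗ H) k j ≡ μ j * H k j) →
    IsDiagonal (transpose H ⊗ L ⊗ H)
  eigencolumns⇒diagonal {n} H L c μ orth eigen i j i≢j = *-cancelˡ-≡ c _ _ (begin
    c * (transpose H ⊗ L ⊗ H) i j
      ≡⟨ cong (c *_) (⊗-assoc (transpose H) L H i j) ⟩
    c * sumFin n (λ k → H k i * (L ⊗ H) k j)
      ≡⟨ sym (sumFin-*ˡ n c _) ⟩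
    sumFin n (λ k → c * (H k i * (L ⊗ H) k j))
      ≡⟨ sumFin-cong n (λ k → trans (x∙yz≈y∙xz c (H k i) _) (cong (H k i *_) (eigen k j))) ⟩
    sumFin n (λ k → H k i * (μ j * H k j))
      ≡⟨ sumFin-cong n (λ k → x∙yz≈y∙xz (H k i) (μ j) (H k j)) ⟩
    sumFin n (λ k → μ j * (H k i * H k j))
      ≡⟨ sumFin-*ˡ n (μ j) _ ⟩
    μ j * (transpose H ⊗ H) i j
      ≡⟨ cong (μ j *_) (orth i j i≢j) ⟩
    μ j * 0ℤ
      ≡⟨ *-zeroʳ (μ j) ⟩
    0ℤ
      ≡⟨ sym (*-zeroʳ c) ⟩
    c * 0ℤ ∎)

  rankTwo-eigencolumns : ∀ {n} (H L : Matrix n) (d : ℤ) →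
    (∀ i j → (transpose H ⊗ H) i j ≡ scalarId d i j) →
    (c α β γ : ℤ) (p q : Fin n) →
    (∀ k l → c * L k l ≡ α * δ k l + β * (H k p * H l p) + γ * (H k q * H l q)) →
    ∀ k j → c * (L ⊗ H) k j ≡ (α + β * scalarId d p j + γ * scalarId d q j) * H k j
  rankTwo-eigencolumns {n} H L d gram c α β γ p q cL k j = begin
    c * sumFin n (λ l → L k l * H l j)
      ≡⟨ sym (sumFin-*ˡ n c _) ⟩
    sumFin n (λ l → c * (L k l * H l j))
      ≡⟨ sumFin-cong n expand ⟩
    sumFin n (λ l → α * (δ k l * H l j) + (β * H k p) * (H l p * H l j) + (γ * H k q) * (H l q * H l j))
      ≡⟨ sumFin-linear₃ n α (β * H k p) (γ * H k q) _ _ _ ⟩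
    α * sumFin n (λ l → δ k l * H l j) + (β * H k p) * (transpose H ⊗ H) p j
      + (γ * H k q) * (transpose H ⊗ H) q j
      ≡⟨ cong₂ _+_ (cong₂ _+_ (cong (α *_) (sumFin-δ n (λ l → H l j) k))
                              (cong ((β * H k p) *_) (gram p j)))
                   (cong ((γ * H k q) *_) (gram q j)) ⟩
    α * H k j + (β * H k p) * scalarId d p j + (γ * H k q) * scalarId d q j
      ≡⟨ cong₂ _+_ (cong (_+_ (α * H k j)) (moveEntry β p)) (moveEntry γ q) ⟩
    α * H k j + β * (scalarId d p j * H k j) + γ * (scalarId d q j * H k j)
      ≡⟨ collect α β γ (scalarId d p j) (scalarId d q j) (H k j) ⟩
    (α + β * scalarId d p j + γ * scalarId d q j) * H k j ∎
    where
    distribute : ∀ α e β a b γ a′ b′ x →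
      (α * e + β * (a * b) + γ * (a′ * b′)) * x ≡ α * (e * x) + (β * a) * (b * x) + (γ * a′) * (b′ * x)
    distribute = solve-∀

    collect : ∀ α β γ s t x → α * x + β * (s * x) + γ * (t * x) ≡ (α + β * s + γ * t) * x
    collect = solve-∀

    expand : ∀ l → c * (L k l * H l j)
      ≡ α * (δ k l * H l j) + (β * H k p) * (H l p * H l j) + (γ * H k q) * (H l q * H l j)
    expand l = begin
      c * (L k l * H l j)   ≡⟨ sym (*-assoc c (L k l) (H l j)) ⟩
      c * L k l * H l j     ≡⟨ cong (_* H l j) (cL k l) ⟩
      (α * δ k l + β * (H k p * H l p) + γ * (H k q * H l q)) * H l j
                            ≡⟨ distribute α (δ k l) β (H k p) (H l p) γ (H k q) (H l q) (H l j) ⟩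
      α * (δ k l * H l j) + (β * H k p) * (H l p * H l j) + (γ * H k q) * (H l q * H l j) ∎

    moveEntry : ∀ x r → (x * H k r) * scalarId d r j ≡ x * (scalarId d r j * H k j)
    moveEntry x r = trans (*-assoc x (H k r) _) (cong (x *_) (scalarId-swap (λ i → H k i) d r j))

  adjacency : ∀ {n} → Graph n → Matrix n
  adjacency G u v = if adj G u v then 1ℤ else 0ℤ

  laplacian≡degree-adjacency : ∀ {n} (G : Graph n) u v →
                               laplacian G u v ≡ degree G u * δ u v - adjacency G u v
  laplacian≡degree-adjacency G u v with u ≟ v
  ... | yes refl rewrite irrefl G u = sym (trans (+-identityʳ _) (*-identityʳ (degree G u)))
  ... | no _ with adj G u v
  ...   | true  = sym (cong (_- 1ℤ) (*-zeroʳ (degree G u)))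
  ...   | false = sym (cong (_- 0ℤ) (*-zeroʳ (degree G u)))

  -- In matrix form 2A = aI + bJ + g s sᵀ; the factor 2 keeps the coefficients integral.
  record AdjacencyForm {n} (G : Graph n) (s : Fin n → ℤ) (a b g : ℤ) : Set where
    constructor adjacencyForm
    field twiceAdjacency : ∀ u v → + 2 * adjacency G u v ≡ a * δ u v + b + g * (s u * s v)

  adjacencyForm-cong : ∀ {n} {G : Graph n} {s t : Fin n → ℤ} {a b g} → (∀ u → s u ≡ t u) →
                       AdjacencyForm G s a b g → AdjacencyForm G t a b g
  adjacencyForm-cong {a = a} {b} {g} s≗t (adjacencyForm form) = adjacencyForm λ u v →
    trans (form u v) (cong (λ x → a * δ u v + b + g * x) (cong₂ _*_ (s≗t u) (s≗t v)))

  laplacian-form : ∀ {n} (G : Graph n) (s : Fin n → ℤ) {a b g} → sumFin n s ≡ 0ℤ →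
    AdjacencyForm G s a b g →
    ∀ u v → + 2 * laplacian G u v ≡ (b * + n) * δ u v + (- b) + (- g) * (s u * s v)
  laplacian-form {n} G s {a} {b} {g} Σs≡0 (adjacencyForm form) u v = begin
    + 2 * laplacian G u v
      ≡⟨ cong (+ 2 *_) (laplacian≡degree-adjacency G u v) ⟩
    + 2 * (degree G u * δ u v - adjacency G u v)
      ≡⟨ double (degree G u) (δ u v) (adjacency G u v) ⟩
    (+ 2 * degree G u) * δ u v - + 2 * adjacency G u v
      ≡⟨ cong₂ (λ x y → x * δ u v - y) twiceDegree (form u v) ⟩
    (a + b * + n) * δ u v - (a * δ u v + b + g * (s u * s v))
      ≡⟨ cancel a b g (+ n) (δ u v) (s u * s v) ⟩
    (b * + n) * δ u v + (- b) + (- g) * (s u * s v) ∎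
    where
    double : ∀ x e y → + 2 * (x * e - y) ≡ (+ 2 * x) * e - + 2 * y
    double = solve-∀

    cancel : ∀ a b g N e x → (a + b * N) * e - (a * e + b + g * x) ≡ (b * N) * e + (- b) + (- g) * x
    cancel = solve-∀

    regroup : ∀ a b g e x y → a * e + b + g * (x * y) ≡ a * (e * 1ℤ) + b * 1ℤ + (g * x) * y
    regroup = solve-∀

    evaluate : ∀ a b g N → a * 1ℤ + b * (1ℤ * N) + g * 0ℤ ≡ a + b * N
    evaluate = solve-∀

    twiceDegree : + 2 * degree G u ≡ a + b * + n
    twiceDegree = begin
      + 2 * sumFin n (adjacency G u)
        ≡⟨ sym (sumFin-*ˡ n (+ 2) _) ⟩
      sumFin n (λ v → + 2 * adjacency G u v)
        ≡⟨ sumFin-cong n (λ v → trans (form u v) (regroup a b g (δ u v) (s u) (s v))) ⟩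
      sumFin n (λ v → a * (δ u v * 1ℤ) + b * 1ℤ + (g * s u) * s v)
        ≡⟨ sumFin-linear₃ n a b (g * s u) _ _ s ⟩
      a * sumFin n (λ v → δ u v * 1ℤ) + b * sumFin n (λ _ → 1ℤ) + (g * s u) * sumFin n s
        ≡⟨ cong₂ _+_ (cong₂ _+_ (cong (a *_) (sumFin-δ n (λ _ → 1ℤ) u))
                                (cong (b *_) (sumFin-const n 1ℤ)))
                     (cong ((g * s u) *_) Σs≡0) ⟩
      a * 1ℤ + b * (1ℤ * + n) + (g * s u) * 0ℤ
        ≡⟨ evaluate a b (g * s u) (+ n) ⟩
      a + b * + n ∎

  hadamard⇒orthogonal : ∀ {n} {H : Matrix n} → IsHadamard n H → IsDiagonal (transpose H ⊗ H)
  hadamard⇒orthogonal {n} (_ , gram) i j i≢j = trans (gram i j) (scalarId-≢ (+ n) i≢j)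

  columnSum≡0 : ∀ {n} (H : Matrix n) → IsDiagonal (transpose H ⊗ H) →
                (p q : Fin n) → p ≢ q → (∀ k → H k p ≡ 1ℤ) → sumFin n (λ k → H k q) ≡ 0ℤ
  columnSum≡0 {n} H orth p q p≢q ones = begin
    sumFin n (λ k → H k q)
      ≡⟨ sumFin-cong n (λ k → sym (trans (cong (_* H k q) (ones k)) (*-identityˡ (H k q)))) ⟩
    (transpose H ⊗ H) p q
      ≡⟨ orth p q p≢q ⟩
    0ℤ ∎

  adjacencyForm⇒diagonal : ∀ {n} (H : Matrix n) → IsHadamard n H → (p q : Fin n) → p ≢ q →
    (∀ k → H k p ≡ 1ℤ) → (G : Graph n) {a b g : ℤ} → AdjacencyForm G (λ k → H k q) a b g →
    IsDiagonal (transpose H ⊗ laplacian G ⊗ H)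
  adjacencyForm⇒diagonal {n} H had@(_ , gram) p q p≢q ones G {b = b} {g} form =
    eigencolumns⇒diagonal H (laplacian G) (+ 2)
      (λ j → b * + n + (- b) * scalarId (+ n) p j + (- g) * scalarId (+ n) q j) orth
      (rankTwo-eigencolumns H (laplacian G) (+ n) gram (+ 2) (b * + n) (- b) (- g) p q twiceLaplacian)
    where
    orth : IsDiagonal (transpose H ⊗ H)
    orth = hadamard⇒orthogonal had

    twiceLaplacian : ∀ k l → + 2 * laplacian G k l
      ≡ (b * + n) * δ k l + (- b) * (H k p * H l p) + (- g) * (H k q * H l q)
    twiceLaplacian k l =
      trans (laplacian-form G (λ k → H k q) (columnSum≡0 H orth p q p≢q ones) form k l)
            (cong (λ x → (b * + n) * δ k l + x + (- g) * (H k q * H l q))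
                  (sym (trans (cong ((- b) *_) (cong₂ _*_ (ones k) (ones l))) (*-identityʳ (- b)))))

  eqℕ⇒≡ : ∀ a b → eqℕ a b ≡ true → a ≡ b
  eqℕ⇒≡ zero    zero    _ = refl
  eqℕ⇒≡ (suc a) (suc b) e = cong suc (eqℕ⇒≡ a b e)

  neq-refl : ∀ {n} (u : Fin n) → neq u u ≡ false
  neq-refl u = cong not (eqℕ-refl (toℕ u))

  neq-≢ : ∀ {n} {u v : Fin n} → u ≢ v → neq u v ≡ true
  neq-≢ {u = u} {v} u≢v with eqℕ (toℕ u) (toℕ v) in eq
  ... | true  = ⊥-elim (u≢v (toℕ-injective (eqℕ⇒≡ (toℕ u) (toℕ v) eq)))
  ... | false = refl

  sideSign : ∀ {m} → Fin (m ℕ.+ m) → ℤ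
  sideSign {m} u = if side {m} u then 1ℤ else - 1ℤ

  completeGraph-form : ∀ {n} (s : Fin n → ℤ) → AdjacencyForm (completeGraph n) s (- + 2) (+ 2) 0ℤ
  completeGraph-form s = adjacencyForm twiceAdjacency
    where
    twiceAdjacency : ∀ u v → + 2 * adjacency (completeGraph _) u v ≡ - + 2 * δ u v + + 2 + 0ℤ * (s u * s v)
    twiceAdjacency u v with u ≟ v
    ... | yes refl rewrite neq-refl u = refl
    ... | no u≢v rewrite neq-≢ u≢v = refl

  edgelessGraph-form : ∀ {n} (s : Fin n → ℤ) → AdjacencyForm (edgelessGraph n) s 0ℤ 0ℤ 0ℤ
  edgelessGraph-form s = adjacencyForm λ _ _ → refl

  completeBipartiteGraph-form : ∀ m → AdjacencyForm (completeBipartiteGraph m) (sideSign {m}) 0ℤ 1ℤ (- 1ℤ)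
  completeBipartiteGraph-form m = adjacencyForm twiceAdjacency
    where
    twiceAdjacency : ∀ u v → + 2 * adjacency (completeBipartiteGraph m) u v
                    ≡ 0ℤ * δ u v + 1ℤ + - 1ℤ * (sideSign {m} u * sideSign {m} v)
    twiceAdjacency u v with side {m} u | side {m} v
    ... | true  | true  = refl
    ... | true  | false = refl
    ... | false | true  = refl
    ... | false | false = refl

  twoCliquesGraph-form : ∀ m → AdjacencyForm (twoCliquesGraph m) (sideSign {m}) (- + 2) 1ℤ 1ℤ
  twoCliquesGraph-form m = adjacencyForm twiceAdjacency
    where
    twiceAdjacency : ∀ u v → + 2 * adjacency (twoCliquesGraph m) u v
                    ≡ - + 2 * δ u v + 1ℤ + 1ℤ * (sideSign {m} u * sideSign {m} v)
    twiceAdjacency u v with u ≟ v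
    twiceAdjacency u v | yes refl rewrite neq-refl u with side {m} u
    ... | true  = refl
    ... | false = refl
    twiceAdjacency u v | no u≢v rewrite neq-≢ u≢v with side {m} u | side {m} v
    ... | true  | true  = refl
    ... | true  | false = refl
    ... | false | true  = refl
    ... | false | false = refl

  IsUnit : ℤ → Set
  IsUnit x = x ≡ 1ℤ ⊎ x ≡ - 1ℤ

  unit-* : ∀ {a b} → IsUnit a → IsUnit b → IsUnit (a * b)
  unit-* (inj₁ refl) (inj₁ refl) = inj₁ refl
  unit-* (inj₁ refl) (inj₂ refl) = inj₂ refl
  unit-* (inj₂ refl) (inj₁ refl) = inj₂ refl
  unit-* (inj₂ refl) (inj₂ refl) = inj₁ refl

  unit-square : ∀ {a} → IsUnit a → a * a ≡ 1ℤ
  unit-square (inj₁ refl) = refl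
  unit-square (inj₂ refl) = refl

  unit≢1⇒-1 : ∀ {a} → IsUnit a → a ≢ 1ℤ → a ≡ - 1ℤ
  unit≢1⇒-1 (inj₁ a≡1)  a≢1 = ⊥-elim (a≢1 a≡1)
  unit≢1⇒-1 (inj₂ a≡-1) _   = a≡-1

  normalizeBy : ∀ {n} → Fin n → Matrix n → Matrix n
  normalizeBy p H k j = H k p * H k j

  normalizeBy-column : ∀ {n} (p : Fin n) {H : Matrix n} → IsHadamard n H → ∀ k → normalizeBy p H k p ≡ 1ℤ
  normalizeBy-column p (units , _) k = unit-square (units k p)

  normalizeBy-hadamard : ∀ {n} (p : Fin n) {H : Matrix n} → IsHadamard n H → IsHadamard n (normalizeBy p H)
  normalizeBy-hadamard {n} p {H} (units , gram) =
    (λ k j → unit-* (units k p) (units k j)) ,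
    (λ i j → trans (sumFin-cong n (λ k → cancelRowSign k i j)) (gram i j))
    where
    rearrange : ∀ a b c → (a * b) * (a * c) ≡ (a * a) * (b * c)
    rearrange = solve-∀

    cancelRowSign : ∀ k i j → normalizeBy p H k i * normalizeBy p H k j ≡ H k i * H k j
    cancelRowSign k i j = begin
      (H k p * H k i) * (H k p * H k j) ≡⟨ rearrange (H k p) (H k i) (H k j) ⟩
      (H k p * H k p) * (H k i * H k j) ≡⟨ cong (_* (H k i * H k j)) (unit-square (units k p)) ⟩
      1ℤ * (H k i * H k j)              ≡⟨ *-identityˡ _ ⟩
      H k i * H k j                     ∎

  sumList : {A : Set} → (A → ℤ) → List A → ℤ
  sumList g []       = 0ℤ
  sumList g (x ∷ xs) = g x + sumList g xs

  sumList-++ : ∀ {A : Set} (g : A → ℤ) xs ys → sumList g (xs ++ ys) ≡ sumList g xs + sumList g ys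
  sumList-++ g []       ys = sym (+-identityˡ _)
  sumList-++ g (x ∷ xs) ys = trans (cong (_+_ (g x)) (sumList-++ g xs ys)) (sym (+-assoc (g x) _ _))

  sumList-tabulate : ∀ {A : Set} n (g : A → ℤ) (F : Fin n → A) → sumList g (tabulate F) ≡ sumFin n (g ∘ F)
  sumList-tabulate zero    g F = refl
  sumList-tabulate (suc n) g F = cong (_+_ (g (F fzero))) (sumList-tabulate n g (F ∘ fsuc))

  sumList-const : ∀ {A : Set} (g : A → ℤ) c {xs} → All (λ x → g x ≡ c) xs → sumList g xs ≡ c * + length xs
  sumList-const g c []                = sym (*-zeroʳ c)
  sumList-const g c {_ ∷ xs} (e ∷ es) = trans (cong₂ _+_ e (sumList-const g c es)) (sym (*-suc c (+ length xs)))

  module _ {A : Set} {P : Pred A 0ℓ} (P? : Decidable P) where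

    sumList-partition : ∀ (g : A → ℤ) xs →
      sumList g (filter P? xs) + sumList g (filter (∁? P?) xs) ≡ sumList g xs
    sumList-partition g []       = refl
    sumList-partition g (x ∷ xs) with P? x
    ... | yes _ = trans (+-assoc (g x) _ _) (cong (_+_ (g x)) (sumList-partition g xs))
    ... | no  _ = trans (x+[y+z]≡y+[x+z] (sumList g (filter P? xs)) (g x) _) (cong (_+_ (g x)) (sumList-partition g xs))

    length-partition : ∀ xs → length (filter P? xs) ℕ.+ length (filter (∁? P?) xs) ≡ length xs
    length-partition []       = refl
    length-partition (x ∷ xs) with P? x
    ... | yes _ = cong suc (length-partition xs)
    ... | no  _ = trans (ℕ.+-suc _ _) (cong suc (length-partition xs))

  lookupOr : {A : Set} → A → List A → ℕ → A
  lookupOr d []       _       = d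
  lookupOr d (x ∷ xs) zero    = x
  lookupOr d (x ∷ xs) (suc i) = lookupOr d xs i

  sumFin-lookupOr : ∀ {A : Set} (d : A) (g : A → ℤ) xs {n} → length xs ≡ n →
                    sumFin n (λ k → g (lookupOr d xs (toℕ k))) ≡ sumList g xs
  sumFin-lookupOr d g []       refl = refl
  sumFin-lookupOr d g (x ∷ xs) refl = cong (_+_ (g x)) (sumFin-lookupOr d g xs refl)

  All-lookupOr : ∀ {A : Set} {P : A → Set} (d : A) {xs} i → All P xs → i < length xs → P (lookupOr d xs i)
  All-lookupOr d zero    (px ∷ _)   _         = px
  All-lookupOr d (suc i) (_  ∷ pxs) (ℕ.s≤s i<n) = All-lookupOr d i pxs i<n

  lookupOr-++ˡ : ∀ {A : Set} (d : A) xs ys i → i < length xs → lookupOr d (xs ++ ys) i ≡ lookupOr d xs i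
  lookupOr-++ˡ d (x ∷ xs) ys zero    _           = refl
  lookupOr-++ˡ d (x ∷ xs) ys (suc i) (ℕ.s≤s i<n) = lookupOr-++ˡ d xs ys i i<n

  lookupOr-++ʳ : ∀ {A : Set} (d : A) xs ys i → lookupOr d (xs ++ ys) (length xs ℕ.+ i) ≡ lookupOr d ys i
  lookupOr-++ʳ d []       ys i = refl
  lookupOr-++ʳ d (x ∷ xs) ys i = lookupOr-++ʳ d xs ys i

  Row : ℕ → Set
  Row n = Fin n → ℤ

  entry≟1 : ∀ {n} (q : Fin n) → Decidable (λ (r : Row n) → r q ≡ 1ℤ)
  entry≟1 q r = r q ℤ.≟ 1ℤ

  plusRows minusRows : ∀ {n} → Fin n → Matrix n → List (Row n)
  plusRows  q H = filter (entry≟1 q) (tabulate H)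
  minusRows q H = filter (∁? (entry≟1 q)) (tabulate H)

  sortedRows : ∀ {n} → Fin n → Matrix n → List (Row n)
  sortedRows q H = plusRows q H ++ minusRows q H

  -- The default row is never used: sortedRows q H has exactly n rows.
  sortRowsBy : ∀ {n} → Fin n → Matrix n → Matrix n
  sortRowsBy q H k = lookupOr (λ _ → 0ℤ) (sortedRows q H) (toℕ k)

  module _ {n : ℕ} (q : Fin n) (H : Matrix n) where

    length-plusRows+minusRows : length (plusRows q H) ℕ.+ length (minusRows q H) ≡ n
    length-plusRows+minusRows = trans (length-partition (entry≟1 q) (tabulate H)) (length-tabulate H)

    length-sortedRows : length (sortedRows q H) ≡ n
    length-sortedRows = trans (length-++ (plusRows q H)) length-plusRows+minusRows

    sumList-sortedRows : ∀ (g : Row n → ℤ) → sumList g (sortedRows q H) ≡ sumFin n (g ∘ H)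
    sumList-sortedRows g = begin
      sumList g (plusRows q H ++ minusRows q H)
        ≡⟨ sumList-++ g (plusRows q H) (minusRows q H) ⟩
      sumList g (plusRows q H) + sumList g (minusRows q H)
        ≡⟨ sumList-partition (entry≟1 q) g (tabulate H) ⟩
      sumList g (tabulate H)
        ≡⟨ sumList-tabulate n g H ⟩
      sumFin n (g ∘ H) ∎

    sortRowsBy-sum : ∀ (g : Row n → ℤ) → sumFin n (λ k → g (sortRowsBy q H k)) ≡ sumFin n (g ∘ H)
    sortRowsBy-sum g =
      trans (sumFin-lookupOr (λ _ → 0ℤ) g (sortedRows q H) length-sortedRows)
            (sumList-sortedRows g)

    sortRowsBy-rows : ∀ {P : Row n → Set} → (∀ k → P (H k)) → ∀ k → P (sortRowsBy q H k)
    sortRowsBy-rows {P} PH k = All-lookupOr {P = P} (λ _ → 0ℤ) (toℕ k)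
      (++⁺ (filter⁺ (entry≟1 q) allRows) (filter⁺ (∁? (entry≟1 q)) allRows))
      (subst (toℕ k <_) (sym length-sortedRows) (toℕ<n k))
      where
      allRows : All P (tabulate H)
      allRows = tabulate⁺ {P = P} PH

  sortRowsBy-hadamard : ∀ {n} (q : Fin n) {H : Matrix n} → IsHadamard n H → IsHadamard n (sortRowsBy q H)
  sortRowsBy-hadamard q {H} (units , gram) =
    sortRowsBy-rows q H {P = λ r → ∀ j → IsUnit (r j)} units ,
    λ i j → trans (sortRowsBy-sum q H (λ r → r i * r j)) (gram i j)

  double-injective : ∀ a b → a ℕ.+ a ≡ b ℕ.+ b → a ≡ b
  double-injective zero    zero    _ = refl
  double-injective (suc a) (suc b) e =
    cong suc (double-injective a b (ℕ.suc-injective (trans (sym (ℕ.+-suc a a))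
                                                    (trans (ℕ.suc-injective e) (ℕ.+-suc b b)))))

  module _ {m : ℕ} (q : Fin (m ℕ.+ m)) (H : Matrix (m ℕ.+ m))
           (units : ∀ k → IsUnit (H k q)) (columnSum : sumFin (m ℕ.+ m) (λ k → H k q) ≡ 0ℤ) where

    private
      P N : List (Row (m ℕ.+ m))
      P = plusRows q H
      N = minusRows q H

      entry : Row (m ℕ.+ m) → ℤ
      entry r = r q

    all-plusRows : All (λ r → r q ≡ 1ℤ) P
    all-plusRows = all-filter (entry≟1 q) (tabulate H)

    all-minusRows : All (λ r → r q ≡ - 1ℤ) N
    all-minusRows = All.map (λ (r≢1 , unit) → unit≢1⇒-1 unit r≢1)
      (All.zip (all-filter (∁? (entry≟1 q)) (tabulate H) ,
                filter⁺ (∁? (entry≟1 q)) (tabulate⁺ {P = λ r → IsUnit (r q)} units)))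

    length-plusRows≡length-minusRows : length P ≡ length N
    length-plusRows≡length-minusRows = +-injective (i-j≡0⇒i≡j _ _ (begin
      + length P - + length N
        ≡⟨ signed (+ length P) (+ length N) ⟩
      1ℤ * + length P + - 1ℤ * + length N
        ≡⟨ sym (cong₂ _+_ (sumList-const entry 1ℤ all-plusRows) (sumList-const entry (- 1ℤ) all-minusRows)) ⟩
      sumList entry P + sumList entry N
        ≡⟨ sym (sumList-++ entry P N) ⟩
      sumList entry (P ++ N)
        ≡⟨ sumList-sortedRows q H entry ⟩
      sumFin (m ℕ.+ m) (λ k → H k q)
        ≡⟨ columnSum ⟩
      0ℤ ∎))
      where
      signed : ∀ x y → x - y ≡ 1ℤ * x + - 1ℤ * y
      signed = solve-∀

    length-plusRows : length P ≡ m
    length-plusRows = double-injective _ _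
      (trans (cong (length P ℕ.+_) length-plusRows≡length-minusRows) (length-plusRows+minusRows q H))

    length-minusRows : length N ≡ m
    length-minusRows = trans (sym length-plusRows≡length-minusRows) length-plusRows

    sortRowsBy-column : ∀ k → sortRowsBy q H k q ≡ sideSign {m} k
    sortRowsBy-column k with toℕ k <ᵇ m | ℕ.<ᵇ-reflects-< (toℕ k) m
    ... | true | ofʸ k<m = begin
      lookupOr d (P ++ N) (toℕ k) q ≡⟨ cong entry (lookupOr-++ˡ d P N (toℕ k) k<|P|) ⟩
      lookupOr d P (toℕ k) q        ≡⟨ All-lookupOr d (toℕ k) all-plusRows k<|P| ⟩
      1ℤ                            ∎
      where
      d : Row (m ℕ.+ m)
      d = λ _ → 0ℤ
      k<|P| : toℕ k < length P
      k<|P| = subst (toℕ k <_) (sym length-plusRows) k<m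
    ... | false | ofⁿ k≮m = begin
      lookupOr d (P ++ N) (toℕ k) q                  ≡⟨ cong (λ i → lookupOr d (P ++ N) i q) k≡|P|+i ⟩
      lookupOr d (P ++ N) (length P ℕ.+ i) q         ≡⟨ cong entry (lookupOr-++ʳ d P N i) ⟩
      lookupOr d N i q                               ≡⟨ All-lookupOr d i all-minusRows i<|N| ⟩
      - 1ℤ                                           ∎
      where
      d : Row (m ℕ.+ m)
      d = λ _ → 0ℤ
      m≤k : m ℕ.≤ toℕ k
      m≤k = ℕ.≮⇒≥ k≮m
      i : ℕ
      i = toℕ k ℕ.∸ m
      k≡|P|+i : toℕ k ≡ length P ℕ.+ i
      k≡|P|+i = trans (sym (ℕ.m+[n∸m]≡n m≤k)) (cong (ℕ._+ i) (sym length-plusRows))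
      i<|N| : i < length N
      i<|N| = subst (i <_) (trans (ℕ.m+n∸m≡n m m) (sym length-minusRows)) (ℕ.∸-monoˡ-< (toℕ<n k) m≤k)

  standardHadamard : ∀ m (H : Matrix (m ℕ.+ m)) → IsHadamard (m ℕ.+ m) H →
    (p q : Fin (m ℕ.+ m)) → p ≢ q →
    Σ[ H′ ∈ Matrix (m ℕ.+ m) ] IsHadamard (m ℕ.+ m) H′
                             × (∀ k → H′ k p ≡ 1ℤ) × (∀ k → H′ k q ≡ sideSign {m} k)
  standardHadamard m H had p q p≢q =
    sortRowsBy q H₁ ,
    sortRowsBy-hadamard q had₁ ,
    sortRowsBy-rows q H₁ {P = λ r → r p ≡ 1ℤ} ones₁ ,
    sortRowsBy-column {m} q H₁ (λ k → proj₁ had₁ k q)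
                                 (columnSum≡0 H₁ (hadamard⇒orthogonal had₁) p q p≢q ones₁)
    where
    H₁ : Matrix (m ℕ.+ m)
    H₁ = normalizeBy p H

    had₁ : IsHadamard (m ℕ.+ m) H₁
    had₁ = normalizeBy-hadamard p had

    ones₁ : ∀ k → H₁ k p ≡ 1ℤ
    ones₁ = normalizeBy-column p had

  adjacencyForm⇒diagonalizable : ∀ {m} → Σ (Matrix (suc m ℕ.+ suc m)) (IsHadamard (suc m ℕ.+ suc m)) →
    ∀ {G a b g} → AdjacencyForm G (sideSign {suc m}) a b g → HadamardDiagonalizable G
  adjacencyForm⇒diagonalizable {m} (H , had) {G} form =
    let (H′ , had′ , ones , signs) = standardHadamard (suc m) H had p q (λ ())
    in H′ , had′ , adjacencyForm⇒diagonal H′ had′ p q (λ ()) ones G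
                     (adjacencyForm-cong (λ k → sym (signs k)) form)
    where
    p q : Fin (suc m ℕ.+ suc m)
    p = fzero
    q = fsuc (m ↑ʳ fzero)

open HadamardDiagonalization
  using ( adjacencyForm⇒diagonalizable; sideSign; completeGraph-form
        ; completeBipartiteGraph-form; edgelessGraph-form; twoCliquesGraph-form )
open import Defs
open import Data.Nat using (ℕ; zero; suc; _+_)
open import Data.Product using (Σ; _×_; _,_)

mainTheorem3 : (m : ℕ) → Σ (Matrix (m + m)) (IsHadamard (m + m)) →
    HadamardDiagonalizable (completeGraph (m + m))
    × HadamardDiagonalizable (completeBipartiteGraph m)
    × HadamardDiagonalizable (edgelessGraph (m + m))
    × HadamardDiagonalizable (twoCliquesGraph m)
mainTheorem3 zero (H , had) = (H , had , λ ()) , (H , had , λ ()) , (H , had , λ ()) , (H , had , λ ())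
mainTheorem3 (suc m) hadamard =
  adjacencyForm⇒diagonalizable hadamard (completeGraph-form (sideSign {suc m})) ,
  adjacencyForm⇒diagonalizable hadamard (completeBipartiteGraph-form (suc m)) ,
  adjacencyForm⇒diagonalizable hadamard (edgelessGraph-form (sideSign {suc m})) ,
  adjacencyForm⇒diagonalizable hadamard (twoCliquesGraph-form (suc m))
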